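{- Let $n \ge k \ge 1$ with $n+k$ odd. Then for all $1 \le i \le n$ and $1 \le j \le k$, the map $\mathrm{SCS}_{i\,j}$ on $\mathrm{M}_{n\,k}(\mathbb F)$ is an invertible linear map satisfying $\det_{n\,k}(\mathrm{SCS}_{i\,j}(X)) = \det_{n\,k}(X)$ for all $X \in \mathrm{M}_{n\,k}(\mathbb F)$.
   Context: $\mathbb F$ is a field. For $n \ge k$ and $X=(x_{i\,j})\in\mathrm{M}_{n\,k}(\mathbb F)$, the Cullis determinant is $\det_{n\,k}(X) = \sum_{\sigma} \operatorname{sgn}_{n\,k}(\sigma)\, x_{\sigma(1)\,1}\cdots x_{\sigma(k)\,k}$, the sum over all injections $\sigma\colon\{1,\ldots,k\}\to\{1,\ldots,n\}$, where, writing $\sigma(\{1,\dots,k\})=\{i_1<\cdots<i_k\}$, $\operatorname{sgn}_{n\,k}(\sigma)=\operatorname{sgn}(\pi_\sigma)(-1)^{\sum_{\alpha=1}^k(i_\alpha-\alpha)}$ with $\pi_\sigma$ the permutation of $\{i_1,\dots,i_k\}$ sending $i_\alpha\mapsto\sigma(\alpha)$. For $1\le i\le n$, $1\le j\le k$, define $\mathrm{SCS}_{i\,j}\colon\mathrm{M}_{n\,k}(\mathbb F)\to\mathrm{M}_{n\,k}(\mathbb F)$ as follows. Let $\rho(r) = ((i+r-2) \bmod n)+1$ for $1\le r\le n$ (so row $r$ of the cyclically shifted matrix is row $\rho(r)$ of $X$, and row $i$ of $X$ becomes row $1$). Let $\delta_{1\,j}$ be the Kronecker delta. Then $\mathrm{SCS}_{i\,j}(X)$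 is the matrix with entries: in column $1$, $(-1)^{i+1}(-1)^{1-\delta_{1\,j}}x_{\rho(r)\,j}$ in row $r$; if $j\neq 1$, in column $j$, $(-1)^{i+1}x_{\rho(r)\,1}$ in row $r$; in every column $c\notin\{1,j\}$, $(-1)^{i+1}x_{\rho(r)\,c}$ in row $r$. Equivalently: cyclically shift the rows so row $i$ goes to row $1$, exchange columns $1$ and $j$, multiply the first column by $(-1)^{1-\delta_{1\,j}}$, and multiply all entries by $(-1)^{i+1}$. -}

module Defs where

open import Level using (Level; _⊔_)
open import Algebra.Bundles using (CommutativeRing)
open import Data.Nat as ℕ using (ℕ; zero; suc; _<ᵇ_)
open import Data.Nat.DivMod using (_%_; m%n<n)
open import Data.Fin as Fin using (Fin; toℕ; fromℕ<; _≟_)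
open import Data.Bool using (Bool; true; false; if_then_else_; _∧_; not)
open import Data.List as List using (List; []; _∷_; _++_; concatMap; allFin; map; foldr)
open import Data.Product using (Σ; _×_)
open import Relation.Nullary using (¬_; does)

record Field (c ℓ : Level) : Set (Level.suc (c ⊔ ℓ)) where
  field
    commutativeRing : CommutativeRing c ℓ
  open CommutativeRing commutativeRing public
  field
    1≉0     : ¬ (1# ≈ 0#)
    inverse : ∀ x → ¬ (x ≈ 0#) → Σ Carrier (λ y → x * y ≈ 1#)

Mat : ∀ {a} → Set a → ℕ → ℕ → Set a
Mat A n k = Fin n → Fin k → A

allFuns : (k n : ℕ) → List (Fin k → Fin n)
allFuns zero    n = (λ ()) ∷ []
allFuns (suc k) n =
  concatMap (λ a → map (λ f → λ { Fin.zero → a ; (Fin.suc α) → f α }) (allFuns k n)) (allFin n)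

pairs : (k : ℕ) → List (Fin k × Fin k)
pairs k = List.filter (λ p → Data.Nat.Properties._<?_ (toℕ (Data.Product.proj₁ p)) (toℕ (Data.Product.proj₂ p)))
            (List.cartesianProduct (allFin k) (allFin k))
  where import Data.Nat.Properties
        import Data.Product

isInjective : ∀ {k n} → (Fin k → Fin n) → Bool
isInjective {k} σ = foldr (λ p b → not (does (σ (Data.Product.proj₁ p) ≟ σ (Data.Product.proj₂ p))) ∧ b) true (pairs k)
  where import Data.Product

-- Number of inversions of σ: pairs α < β with σ(α) > σ(β).
-- For injective σ its parity is the sign of the permutation π_σ.
inversions : ∀ {k n} → (Fin k → Fin n) → ℕ
inversions {k} σ = foldr (λ p m → (if toℕ (σ (Data.Product.proj₂ p)) <ᵇ toℕ (σ (Data.Product.proj₁ p)) then 1 else 0) ℕ.+ m) 0 (pairs k)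
  where import Data.Product

-- Σ_{α} σ(α) and Σ_α α (0-based; the difference equals Σ_α (i_α - α) in the paper).
sumImage : ∀ {k n} → (Fin k → Fin n) → ℕ
sumImage {k} σ = foldr (λ α m → toℕ (σ α) ℕ.+ m) 0 (allFin k)

sumIdx : ℕ → ℕ
sumIdx k = foldr (λ (α : Fin k) m → toℕ α ℕ.+ m) 0 (allFin k)

module FieldOps {c ℓ} (F : Field c ℓ) where
  open Field F public

  negOnePow : ℕ → Carrier
  negOnePow zero    = 1#
  negOnePow (suc m) = - (negOnePow m)

  -- sgn_{n k}(σ) for injective σ; σ non-injective contribute 0.
  -- exponent inv(σ) + Σ(i_α - α); parity of Σ σ(α) - Σ α equals that of Σ σ(α) + Σ α.
  sgnNK : ∀ {k n} → (Fin k → Fin n) → Carrier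
  sgnNK {k} σ = negOnePow (inversions σ ℕ.+ (sumImage σ ℕ.+ sumIdx k))

  prodCol : ∀ {n k} → Mat Carrier n k → (Fin k → Fin n) → Carrier
  prodCol {n} {k} X σ = foldr (λ α r → X (σ α) α * r) 1# (allFin k)

  cullisDet : ∀ {n k} → Mat Carrier n k → Carrier
  cullisDet {n} {k} X =
    foldr (λ σ r → (if isInjective σ then sgnNK σ * prodCol X σ else 0#) + r) 0# (allFuns k n)

  -- cyclic row shift ρ(r) = (i + r) mod n  (0-based version of ((i+r-2) mod n)+1)
  rho : ∀ {n} → Fin n → Fin n → Fin n
  rho {suc m} i r = fromℕ< (m%n<n (toℕ i ℕ.+ toℕ r) (suc m))

  -- SCS_{i j} (0-based i, j; (-1)^{i+1} with 1-based i is (-1)^{toℕ i})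
  SCS : ∀ {n k} → Fin n → Fin k → Mat Carrier n k → Mat Carrier n k
  SCS {n} {suc k} i j X r c =
    if does (c ≟ Fin.zero)
    then negOnePow (toℕ i) * (negOnePow (if does (j ≟ Fin.zero) then 0 else 1) * X (rho i r) j)
    else (if does (c ≟ j)
          then negOnePow (toℕ i) * X (rho i r) Fin.zero
          else negOnePow (toℕ i) * X (rho i r) c)

{-# OPTIONS --safe #-}
module Submission where

-- SCS i j X is, entrywise, sign (e c) * X (ρ r) (τ c), where ρ rotates the rows by i, τ is the
-- transposition (0 j) of the columns and e c records the factor (-1)^i and the extra -1 on column 0
-- when j ≠ 0.  This form is visibly linear and invertible.  On the Cullis determinant, scaling the
-- columns contributes (-1)^(ik + [j ≠ 0]), the transposition (-1)^[j ≠ 0], and the rotation (-1)^(ik):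
-- if M of the rows σ(α) wrap around modulo n, composing σ with ρ reverses the order of exactly the
-- M (k - M) pairs split by the wrap and changes Σ σ(α) by ik - nM; for n + k odd the M-terms cancel mod 2.
-- All signs are computed as parities in the Boolean ring (Bool, xor, ∧).

open import Level using (Level)
open import Algebra.Bundles using (Monoid; CommutativeRing)
import Algebra.Properties.CommutativeMonoid.Sum as CommutativeMonoidSum
import Algebra.Properties.CommutativeSemigroup as CommutativeSemigroupProperties
import Algebra.Properties.Semiring.Mult as SemiringMult
import Algebra.Properties.Semiring.Sum as SemiringSum
open import Data.Bool using (Bool; true; false; if_then_else_; _∧_; _xor_; not; T)
open import Data.Bool.Properties
  using (xor-∧-commutativeRing; not-involutive; xor-identityʳ; xor-same; if-float; T-∧; T-≡; ⇔→≡)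
open import Data.Fin using (Fin; zero; suc; toℕ; fromℕ<; _≟_)
open import Data.Fin.Permutation as P using (Permutation′; _⟨$⟩ʳ_; _⟨$⟩ˡ_)
open import Data.Fin.Properties using (toℕ-injective; suc-injective; toℕ-fromℕ<; toℕ<n)
open import Data.List
  using (List; []; _∷_; _++_; map; concatMap; foldr; filter; cartesianProduct; allFin; tabulate)
open import Data.List.Membership.Propositional using (_∈_)
open import Data.List.Membership.Propositional.Properties
  using (∈-filter⁺; ∈-filter⁻; ∈-cartesianProduct⁺; ∈-allFin)
open import Data.List.Properties using (foldr-map; foldr-fusion; foldr-cong)
import Data.List.Relation.Unary.All as All
open import Data.Maybe using (Maybe; just; nothing)
open import Data.Nat as ℕ using (ℕ; NonZero; zero; suc; 2+; _∸_; _<_; _≤_; _<ᵇ_; _≤ᵇ_)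
open import Data.Nat.DivMod
  using (_%_; m%n<n; %-distribˡ-+; m%n%n≡m%n; [m+n]%n≡m%n; m<n⇒m%n≡m; n%n≡0)
open import Data.Nat.Properties using (_<?_; <-cmp; <-irrefl)
import Data.Nat.Properties as ℕₚ
open import Data.Product using (Σ; _×_; _,_; proj₁; proj₂)
open import Data.Vec.Functional using () renaming (_∷_ to _∷ᶠ_)
open import Function using (_∘_; id)
open import Function.Bundles using (_⇔_; mk⇔; Equivalence)
open import Function.Definitions using (Injective)
import Function.Properties.Equivalence as ⇔
open import Relation.Binary.Definitions using (tri<; tri≈; tri>)
open import Relation.Binary.PropositionalEquality
  using (_≡_; _≢_; _≗_; refl; sym; trans; cong; cong₂; subst; module ≡-Reasoning)
open import Relation.Nullary using (¬_; Dec; does; yes; no; ofʸ; ofⁿ; contradiction)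
open import Relation.Nullary.Decidable using (dec-true; dec-false)
open import Relation.Unary using (Pred)
open import Tactic.RingSolver using (solve-∀)
open import Tactic.RingSolver.Core.AlmostCommutativeRing using (AlmostCommutativeRing; fromCommutativeRing)

open import Defs

-- Sums over lists

module ListSum {a ℓ} (M : Monoid a ℓ) where
  open Monoid M renaming (refl to ≈-refl; sym to ≈-sym; trans to ≈-trans; reflexive to ≈-reflexive)
  open import Algebra.Properties.Monoid.Sum M using (sum)
  open import Relation.Binary.Reasoning.Setoid setoid

  private variable
    b c : Level
    A : Set b
    B : Set c

  sumOver : List A → (A → Carrier) → Carrier
  sumOver xs f = foldr (λ x r → f x ∙ r) ε xs

  sumOver-cong : ∀ xs {f g : A → Carrier} → (∀ x → f x ≈ g x) → sumOver xs f ≈ sumOver xs g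
  sumOver-cong []       f≈g = ≈-refl
  sumOver-cong (x ∷ xs) f≈g = ∙-cong (f≈g x) (sumOver-cong xs f≈g)

  sumOver-++ : ∀ xs ys (f : A → Carrier) → sumOver (xs ++ ys) f ≈ sumOver xs f ∙ sumOver ys f
  sumOver-++ []       ys f = ≈-sym (identityˡ _)
  sumOver-++ (x ∷ xs) ys f = begin
    f x ∙ sumOver (xs ++ ys) f           ≈⟨ ∙-congˡ (sumOver-++ xs ys f) ⟩
    f x ∙ (sumOver xs f ∙ sumOver ys f)  ≈⟨ assoc _ _ _ ⟨
    (f x ∙ sumOver xs f) ∙ sumOver ys f  ∎

  sumOver-map : ∀ (g : B → A) xs (f : A → Carrier) → sumOver (map g xs) f ≡ sumOver xs (f ∘ g)
  sumOver-map g xs f = foldr-map _ g ε xs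

  sumOver-concatMap : ∀ (g : B → List A) xs (f : A → Carrier) →
                      sumOver (concatMap g xs) f ≈ sumOver xs (λ x → sumOver (g x) f)
  sumOver-concatMap g []       f = ≈-refl
  sumOver-concatMap g (x ∷ xs) f = ≈-trans (sumOver-++ (g x) _ f) (∙-congˡ (sumOver-concatMap g xs f))

  sumOver-tabulate : ∀ {k} (g : Fin k → A) (f : A → Carrier) →
                     sumOver (tabulate g) f ≡ sum (f ∘ g)
  sumOver-tabulate {k = zero}  g f = refl
  sumOver-tabulate {k = suc k} g f = cong (f (g zero) ∙_) (sumOver-tabulate (g ∘ suc) f)

  sumOver-filter : ∀ {p} {P : Pred A p} (P? : ∀ x → Dec (P x)) xs (f : A → Carrier) →
                   sumOver (filter P? xs) f ≈ sumOver xs (λ x → if does (P? x) then f x else ε)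
  sumOver-filter P? []       f = ≈-refl
  sumOver-filter P? (x ∷ xs) f with does (P? x)
  ... | true  = ∙-congˡ (sumOver-filter P? xs f)
  ... | false = ≈-trans (sumOver-filter P? xs f) (≈-sym (identityˡ _))

  sumOver-cartesianProduct : ∀ (xs : List A) (ys : List B) (f : A × B → Carrier) →
    sumOver (cartesianProduct xs ys) f ≈ sumOver xs (λ x → sumOver ys (λ y → f (x , y)))
  sumOver-cartesianProduct []       ys f = ≈-refl
  sumOver-cartesianProduct (x ∷ xs) ys f = begin
    sumOver (map (x ,_) ys ++ cartesianProduct xs ys) f
      ≈⟨ sumOver-++ (map (x ,_) ys) _ f ⟩
    sumOver (map (x ,_) ys) f ∙ sumOver (cartesianProduct xs ys) f
      ≈⟨ ∙-cong (≈-reflexive (sumOver-map (x ,_) ys f)) (sumOver-cartesianProduct xs ys f) ⟩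
    sumOver ys (λ y → f (x , y)) ∙ sumOver xs (λ x → sumOver ys (λ y → f (x , y))) ∎

-- Parities in the Boolean ring

module 𝔹 = CommutativeRing xor-∧-commutativeRing
module Xor = CommutativeSemigroupProperties 𝔹.+-commutativeSemigroup
module ⊕ = CommutativeMonoidSum 𝔹.+-commutativeMonoid
open SemiringSum 𝔹.semiring using (*-distribʳ-sum)
open SemiringMult 𝔹.semiring using (×-homo-+; ×-assoc-*) renaming (_×_ to _×′_)

𝔹-ring : AlmostCommutativeRing _ _
𝔹-ring = fromCommutativeRing xor-∧-commutativeRing false≟
  where
  false≟ : ∀ b → Maybe (false ≡ b)
  false≟ false = just refl
  false≟ true  = nothing

⨁ : ∀ {k} → (Fin k → Bool) → Bool
⨁ = ⊕.sum

parity : ℕ → Bool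
parity n = n ×′ true

parity-+ : ∀ m n → parity (m ℕ.+ n) ≡ parity m xor parity n
parity-+ m n = ×-homo-+ true m n

⨁-const : ∀ k b → ⨁ {k} (λ _ → b) ≡ parity k ∧ b
⨁-const k b = trans (⊕.sum-replicate k) (sym (×-assoc-* k true b))

module ℕΣ = ListSum ℕₚ.+-0-monoid
module 𝔹Σ = ListSum 𝔹.+-monoid

parity-sumOver : ∀ {a} {A : Set a} (xs : List A) (g : A → ℕ) →
                 parity (ℕΣ.sumOver xs g) ≡ 𝔹Σ.sumOver xs (parity ∘ g)
parity-sumOver xs g = foldr-fusion parity 0 (λ x m → parity-+ (g x) m) xs

%2≡1⇒parity : ∀ n → n % 2 ≡ 1 → parity n ≡ true
%2≡1⇒parity (suc zero)    _      = refl
%2≡1⇒parity (suc (suc n)) n%2≡1 = trans (not-involutive (parity n)) (%2≡1⇒parity n n%2≡1)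

pairParity : ∀ k → (Fin k → Fin k → Bool) → Bool
pairParity zero    g = false
pairParity (suc k) g = ⨁ (g zero ∘ suc) xor pairParity k (λ α β → g (suc α) (suc β))

pairParity-mixed : ∀ k (u : Fin k → Bool) →
                   pairParity k (λ α β → u α xor u β) ≡ ⨁ u ∧ parity (suc k)
pairParity-mixed zero    u = refl
pairParity-mixed (suc k) u = begin
  ⨁ (λ β → u zero xor u (suc β)) xor pairParity k (λ α β → u (suc α) xor u (suc β))
    ≡⟨ cong₂ _xor_ (⊕.∑-distrib-+ (λ _ → u zero) (u ∘ suc))
                   (pairParity-mixed k (u ∘ suc)) ⟩
  (⨁ {k} (λ _ → u zero) xor ⨁ (u ∘ suc)) xor (⨁ (u ∘ suc) ∧ parity (suc k))
    ≡⟨ cong (λ b → (b xor ⨁ (u ∘ suc)) xor (⨁ (u ∘ suc) ∧ parity (suc k)))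
            (⨁-const k (u zero)) ⟩
  ((parity k ∧ u zero) xor ⨁ (u ∘ suc)) xor (⨁ (u ∘ suc) ∧ (true xor parity k))
    ≡⟨ regroup (parity k) (u zero) (⨁ (u ∘ suc)) ⟩
  ⨁ u ∧ parity (suc (suc k)) ∎
  where
  open ≡-Reasoning
  regroup : ∀ p a m → ((p ∧ a) xor m) xor (m ∧ (true xor p)) ≡ (a xor m) ∧ (true xor (true xor p))
  regroup = solve-∀ 𝔹-ring

pairParity-cong : ∀ k {g h : Fin k → Fin k → Bool} → (∀ α β → g α β ≡ h α β) →
                  pairParity k g ≡ pairParity k h
pairParity-cong zero    g≡h = refl
pairParity-cong (suc k) g≡h =
  cong₂ _xor_ (⊕.sum-cong-≗ (g≡h zero ∘ suc))
              (pairParity-cong k (λ α β → g≡h (suc α) (suc β)))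

pairParity-xor : ∀ k (g h : Fin k → Fin k → Bool) →
                 pairParity k (λ α β → g α β xor h α β) ≡ pairParity k g xor pairParity k h
pairParity-xor zero    g h = refl
pairParity-xor (suc k) g h = trans
  (cong₂ _xor_ (⊕.∑-distrib-+ (g zero ∘ suc) (h zero ∘ suc))
               (pairParity-xor k (λ α β → g (suc α) (suc β)) (λ α β → h (suc α) (suc β))))
  (Xor.interchange (⨁ (g zero ∘ suc)) (⨁ (h zero ∘ suc)) _ _)

⨁⨁<≡pairParity : ∀ k (g : Fin k → Fin k → Bool) →
  ⨁ (λ α → ⨁ (λ β → if does (toℕ α <? toℕ β) then g α β else false)) ≡ pairParity k g
⨁⨁<≡pairParity zero    g = refl
⨁⨁<≡pairParity (suc k) g =
  cong (⨁ (g zero ∘ suc) xor_) (⨁⨁<≡pairParity k (λ α β → g (suc α) (suc β)))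

-- The sign of an injection

inversionParity : ∀ {k n} → (Fin k → Fin n) → Bool
inversionParity {k} σ = pairParity k (λ α β → toℕ (σ β) <ᵇ toℕ (σ α))

imageParity : ∀ {k n} → (Fin k → Fin n) → Bool
imageParity σ = ⨁ (λ α → parity (toℕ (σ α)))

signBit : ∀ {k n} → (Fin k → Fin n) → Bool
signBit {k} σ = inversionParity σ xor (imageParity σ xor parity (sumIdx k))

parity-inversions : ∀ {k n} (σ : Fin k → Fin n) → parity (inversions σ) ≡ inversionParity σ
parity-inversions {k} σ = begin
  parity (inversions σ)
    ≡⟨ parity-sumOver (pairs k) (λ p → if inverted p then 1 else 0) ⟩
  𝔹Σ.sumOver (pairs k) (λ p → parity (if inverted p then 1 else 0))
    ≡⟨ 𝔹Σ.sumOver-cong (pairs k) (λ p → parity-indicator (inverted p)) ⟩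
  𝔹Σ.sumOver (pairs k) inverted
    ≡⟨ 𝔹Σ.sumOver-filter ordered? (cartesianProduct (allFin k) (allFin k)) inverted ⟩
  𝔹Σ.sumOver (cartesianProduct (allFin k) (allFin k)) (λ (α , β) → entry α β)
    ≡⟨ 𝔹Σ.sumOver-cartesianProduct (allFin k) (allFin k) (λ (α , β) → entry α β) ⟩
  𝔹Σ.sumOver (allFin k) (λ α → 𝔹Σ.sumOver (allFin k) (entry α))
    ≡⟨ 𝔹Σ.sumOver-tabulate id (λ α → 𝔹Σ.sumOver (allFin k) (entry α)) ⟩
  ⨁ (λ α → 𝔹Σ.sumOver (allFin k) (entry α))
    ≡⟨ ⊕.sum-cong-≗ (λ α → 𝔹Σ.sumOver-tabulate id (entry α)) ⟩
  ⨁ (λ α → ⨁ (entry α))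
    ≡⟨ ⨁⨁<≡pairParity k (λ α β → inverted (α , β)) ⟩
  inversionParity σ ∎
  where
  open ≡-Reasoning
  inverted : Fin k × Fin k → Bool
  inverted (α , β) = toℕ (σ β) <ᵇ toℕ (σ α)
  ordered? : (p : Fin k × Fin k) → Dec (toℕ (proj₁ p) < toℕ (proj₂ p))
  ordered? (α , β) = toℕ α <? toℕ β
  entry : Fin k → Fin k → Bool
  entry α β = if does (toℕ α <? toℕ β) then inverted (α , β) else false
  parity-indicator : ∀ b → parity (if b then 1 else 0) ≡ b
  parity-indicator false = refl
  parity-indicator true  = refl

parity-sumImage : ∀ {k n} (σ : Fin k → Fin n) → parity (sumImage σ) ≡ imageParity σ
parity-sumImage {k} σ =
  trans (parity-sumOver (allFin k) (λ α → toℕ (σ α)))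
        (𝔹Σ.sumOver-tabulate id (λ α → parity (toℕ (σ α))))

parity-signExponent : ∀ {k n} (σ : Fin k → Fin n) →
  parity (inversions σ ℕ.+ (sumImage σ ℕ.+ sumIdx k)) ≡ signBit σ
parity-signExponent {k} σ = begin
  parity (inversions σ ℕ.+ (sumImage σ ℕ.+ sumIdx k))
    ≡⟨ parity-+ (inversions σ) _ ⟩
  parity (inversions σ) xor parity (sumImage σ ℕ.+ sumIdx k)
    ≡⟨ cong₂ _xor_ (parity-inversions σ) (parity-+ (sumImage σ) (sumIdx k)) ⟩
  inversionParity σ xor (parity (sumImage σ) xor parity (sumIdx k))
    ≡⟨ cong (λ b → inversionParity σ xor (b xor parity (sumIdx k))) (parity-sumImage σ) ⟩
  signBit σ ∎
  where open ≡-Reasoning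

T-foldr-∧ : ∀ {a} {A : Set a} (f : A → Bool) xs →
            T (foldr (λ x b → f x ∧ b) true xs) ⇔ All.All (T ∘ f) xs
T-foldr-∧ f []       = mk⇔ (λ _ → All.[]) (λ _ → _)
T-foldr-∧ f (x ∷ xs) = mk⇔
  (λ t → let fx , rest = Equivalence.to T-∧ t in fx All.∷ Equivalence.to (T-foldr-∧ f xs) rest)
  (λ { (fx All.∷ rest) → Equivalence.from T-∧ (fx , Equivalence.from (T-foldr-∧ f xs) rest) })

module _ {k n} (σ : Fin k → Fin n) where

  private
    distinctAt : Fin k × Fin k → Bool
    distinctAt (α , β) = not (does (σ α ≟ σ β))

    ∈-pairs⁺ : ∀ {α β} → toℕ α < toℕ β → (α , β) ∈ pairs k
    ∈-pairs⁺ {α} {β} α<β = ∈-filter⁺ (λ p → toℕ (proj₁ p) <? toℕ (proj₂ p))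
      (∈-cartesianProduct⁺ (∈-allFin α) (∈-allFin β)) α<β

    ∈-pairs⁻ : ∀ {α β} → (α , β) ∈ pairs k → toℕ α < toℕ β
    ∈-pairs⁻ αβ∈ = proj₂ (∈-filter⁻ (λ p → toℕ (proj₁ p) <? toℕ (proj₂ p))
      {xs = cartesianProduct (allFin k) (allFin k)} αβ∈)

    T-not-does : ∀ {a} {A : Set a} (A? : Dec A) → T (not (does A?)) ⇔ (¬ A)
    T-not-does (yes a) = mk⇔ (λ ()) (λ ¬a → ¬a a)
    T-not-does (no ¬a) = mk⇔ (λ _ → ¬a) (λ _ → _)

  T-isInjective : T (isInjective σ) ⇔ Injective _≡_ _≡_ σ
  T-isInjective = mk⇔ injective isInjective-true
    where
    distinct : T (isInjective σ) → ∀ {α β} → toℕ α < toℕ β → σ α ≢ σ β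
    distinct t {α} {β} α<β = Equivalence.to (T-not-does (σ α ≟ σ β))
      (All.lookup (Equivalence.to (T-foldr-∧ distinctAt (pairs k)) t) (∈-pairs⁺ α<β))

    injective : T (isInjective σ) → Injective _≡_ _≡_ σ
    injective t {α} {β} σα≡σβ with <-cmp (toℕ α) (toℕ β)
    ... | tri< α<β _ _ = contradiction σα≡σβ (distinct t α<β)
    ... | tri≈ _ α≡β _ = toℕ-injective α≡β
    ... | tri> _ _ β<α = contradiction (sym σα≡σβ) (distinct t β<α)

    isInjective-true : Injective _≡_ _≡_ σ → T (isInjective σ)
    isInjective-true inj = Equivalence.from (T-foldr-∧ distinctAt (pairs k)) (All.tabulate λ {(α , β)} αβ∈ →
      Equivalence.from (T-not-does (σ α ≟ σ β))
                       (λ σα≡σβ → <-irrefl (cong toℕ (inj σα≡σβ)) (∈-pairs⁻ αβ∈)))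

isInjective-resp : ∀ {k n} {σ τ : Fin k → Fin n} →
  Injective _≡_ _≡_ σ ⇔ Injective _≡_ _≡_ τ → isInjective σ ≡ isInjective τ
isInjective-resp {σ = σ} {τ} σ⇔τ =
  ⇔→≡ (⇔.trans (⇔.sym T-≡) (⇔.trans (T-isInjective σ)
      (⇔.trans σ⇔τ (⇔.trans (⇔.sym (T-isInjective τ)) T-≡))))

⟨$⟩ʳ-injective : ∀ {k} (π : Permutation′ k) → Injective _≡_ _≡_ (π ⟨$⟩ʳ_)
⟨$⟩ʳ-injective π πx≡πy = trans (sym (P.inverseˡ π)) (trans (cong (π ⟨$⟩ˡ_) πx≡πy) (P.inverseˡ π))

isInjective-∘ʳ : ∀ {k n} (σ : Fin k → Fin n) (π : Permutation′ k) →
                 isInjective (σ ∘ (π ⟨$⟩ʳ_)) ≡ isInjective σ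
isInjective-∘ʳ σ π = isInjective-resp (mk⇔ cancel compose)
  where
  cancel : Injective _≡_ _≡_ (σ ∘ (π ⟨$⟩ʳ_)) → Injective _≡_ _≡_ σ
  cancel inj {x} {y} σx≡σy = begin
    x                  ≡⟨ P.inverseʳ π ⟨
    π ⟨$⟩ʳ (π ⟨$⟩ˡ x)  ≡⟨ cong (π ⟨$⟩ʳ_) (inj (trans (cong σ (P.inverseʳ π))
                                           (trans σx≡σy (cong σ (sym (P.inverseʳ π)))))) ⟩
    π ⟨$⟩ʳ (π ⟨$⟩ˡ y)  ≡⟨ P.inverseʳ π ⟩
    y                  ∎
    where open ≡-Reasoning
  compose : Injective _≡_ _≡_ σ → Injective _≡_ _≡_ (σ ∘ (π ⟨$⟩ʳ_))
  compose inj σπx≡σπy = ⟨$⟩ʳ-injective π (inj σπx≡σπy)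

isInjective-∘ˡ : ∀ {k n} (π : Permutation′ n) (σ : Fin k → Fin n) →
                 isInjective ((π ⟨$⟩ʳ_) ∘ σ) ≡ isInjective σ
isInjective-∘ˡ π σ = isInjective-resp (mk⇔ cancel compose)
  where
  cancel : Injective _≡_ _≡_ ((π ⟨$⟩ʳ_) ∘ σ) → Injective _≡_ _≡_ σ
  cancel inj σx≡σy = inj (cong (π ⟨$⟩ʳ_) σx≡σy)
  compose : Injective _≡_ _≡_ σ → Injective _≡_ _≡_ ((π ⟨$⟩ʳ_) ∘ σ)
  compose inj πσx≡πσy = inj (⟨$⟩ʳ-injective π πσx≡πσy)

-- Permutations of the columns

-- Permutations as words in generators, so that their parity can be read off.
data Perm : ℕ → Set where
  idᵖ    : ∀ {k} → Perm k
  swap₀₁ : ∀ {k} → Perm (suc (suc k))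
  lift   : ∀ {k} → Perm k → Perm (suc k)
  _∘ᵖ_   : ∀ {k} → Perm k → Perm k → Perm k

⟦_⟧ : ∀ {k} → Perm k → Permutation′ k
⟦ idᵖ    ⟧ = P.id
⟦ swap₀₁ ⟧ = P.transpose zero (suc zero)
⟦ lift p ⟧ = P.lift₀ ⟦ p ⟧
⟦ p ∘ᵖ q ⟧ = ⟦ q ⟧ P.∘ₚ ⟦ p ⟧

oddPerm : ∀ {k} → Perm k → Bool
oddPerm idᵖ      = false
oddPerm swap₀₁   = true
oddPerm (lift p) = oddPerm p
oddPerm (p ∘ᵖ q) = oddPerm p xor oddPerm q

swap₀ : ∀ {k} → Fin k → Perm k
swap₀ zero          = idᵖ
swap₀ (suc zero)    = swap₀₁
swap₀ (suc (suc j)) = swap₀₁ ∘ᵖ (lift (swap₀ (suc j)) ∘ᵖ swap₀₁)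

swap₀-apply : ∀ {k} (j c : Fin (suc k)) →
  ⟦ swap₀ j ⟧ ⟨$⟩ʳ c ≡ (if does (c ≟ zero) then j else if does (c ≟ j) then zero else c)
swap₀-apply zero          zero          = refl
swap₀-apply zero          (suc c)       = refl
swap₀-apply (suc zero)    zero          = refl
swap₀-apply (suc zero)    (suc zero)    = refl
swap₀-apply (suc zero)    (suc (suc c)) = refl
swap₀-apply (suc (suc j)) zero          = cong (λ c → ⟦ swap₀₁ ⟧ ⟨$⟩ʳ suc c) (swap₀-apply (suc j) zero)
swap₀-apply (suc (suc j)) (suc zero)    = refl
swap₀-apply (suc (suc j)) (suc (suc c)) rewrite swap₀-apply (suc j) (suc c) with does (c ≟ j)
... | true  = refl
... | false = refl

oddPerm-swap₀ : ∀ {k} (j : Fin (suc k)) → oddPerm (swap₀ j) ≡ not (does (j ≟ zero))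
oddPerm-swap₀ zero          = refl
oddPerm-swap₀ (suc zero)    = refl
oddPerm-swap₀ (suc (suc j)) = cong (λ b → true xor (b xor true)) (oddPerm-swap₀ (suc j))

<ᵇ-flip : ∀ {m n} → m ≢ n → (m <ᵇ n) ≡ not (n <ᵇ m)
<ᵇ-flip {zero}  {zero}  m≢n = contradiction refl m≢n
<ᵇ-flip {zero}  {suc n} m≢n = refl
<ᵇ-flip {suc m} {zero}  m≢n = refl
<ᵇ-flip {suc m} {suc n} m≢n = <ᵇ-flip (m≢n ∘ cong suc)

inversionParity-∘ᵖ : ∀ {k n} (p : Perm k) (σ : Fin k → Fin n) → Injective _≡_ _≡_ σ →
  inversionParity (σ ∘ (⟦ p ⟧ ⟨$⟩ʳ_)) ≡ oddPerm p xor inversionParity σ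
inversionParity-∘ᵖ idᵖ σ inj = refl
inversionParity-∘ᵖ swap₀₁ σ inj =
  -- the swap reverses the pair (0, 1) and exchanges the contributions a and b of rows 0 and 1
  trans (cong (λ y → (y xor b) xor (a xor c)) σ₀<σ₁≡not[σ₁<σ₀]) (regroup x a b c)
  where
  x a b c : Bool
  x = toℕ (σ (suc zero)) <ᵇ toℕ (σ zero)
  a = ⨁ (λ β → toℕ (σ (suc (suc β))) <ᵇ toℕ (σ zero))
  b = ⨁ (λ β → toℕ (σ (suc (suc β))) <ᵇ toℕ (σ (suc zero)))
  c = inversionParity (λ α → σ (suc (suc α)))
  σ₀<σ₁≡not[σ₁<σ₀] : (toℕ (σ zero) <ᵇ toℕ (σ (suc zero))) ≡ not x
  σ₀<σ₁≡not[σ₁<σ₀] = <ᵇ-flip (λ e → 0≢1 (inj (toℕ-injective e)))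
    where 0≢1 : zero ≢ suc zero
          0≢1 ()
  regroup : ∀ x a b c → ((true xor x) xor b) xor (a xor c) ≡ true xor ((x xor a) xor (b xor c))
  regroup = solve-∀ 𝔹-ring
inversionParity-∘ᵖ {suc k} (lift p) σ inj = begin
  ⨁ (first ∘ (⟦ p ⟧ ⟨$⟩ʳ_)) xor inversionParity ((σ ∘ suc) ∘ (⟦ p ⟧ ⟨$⟩ʳ_))
    ≡⟨ cong₂ _xor_ (sym (⊕.sum-permute first ⟦ p ⟧))
                   (inversionParity-∘ᵖ p (σ ∘ suc) (λ e → suc-injective (inj e))) ⟩
  ⨁ first xor (oddPerm p xor inversionParity (σ ∘ suc))
    ≡⟨ Xor.x∙yz≈y∙xz (⨁ first) (oddPerm p) (inversionParity (σ ∘ suc)) ⟩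
  oddPerm p xor inversionParity σ ∎
  where
  open ≡-Reasoning
  first : Fin k → Bool
  first β = toℕ (σ (suc β)) <ᵇ toℕ (σ zero)
inversionParity-∘ᵖ (p ∘ᵖ q) σ inj = begin
  inversionParity ((σ ∘ (⟦ p ⟧ ⟨$⟩ʳ_)) ∘ (⟦ q ⟧ ⟨$⟩ʳ_))
    ≡⟨ inversionParity-∘ᵖ q _ (λ e → ⟨$⟩ʳ-injective ⟦ p ⟧ (inj e)) ⟩
  oddPerm q xor inversionParity (σ ∘ (⟦ p ⟧ ⟨$⟩ʳ_))
    ≡⟨ cong (oddPerm q xor_) (inversionParity-∘ᵖ p σ inj) ⟩
  oddPerm q xor (oddPerm p xor inversionParity σ)
    ≡⟨ Xor.x∙yz≈yx∙z (oddPerm q) (oddPerm p) (inversionParity σ) ⟩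
  (oddPerm p xor oddPerm q) xor inversionParity σ ∎
  where open ≡-Reasoning

signBit-∘ᵖ : ∀ {k n} (p : Perm k) (σ : Fin k → Fin n) → Injective _≡_ _≡_ σ →
  signBit (σ ∘ (⟦ p ⟧ ⟨$⟩ʳ_)) ≡ oddPerm p xor signBit σ
signBit-∘ᵖ {k} p σ inj = trans
  (cong₂ (λ a b → a xor (b xor parity (sumIdx k)))
         (inversionParity-∘ᵖ p σ inj)
         (sym (⊕.sum-permute (λ α → parity (toℕ (σ α))) ⟦ p ⟧)))
  (𝔹.+-assoc (oddPerm p) (inversionParity σ) (imageParity σ xor parity (sumIdx k)))

-- Rotation of the rows

<ᵇ-+ˡ : ∀ i m n → (i ℕ.+ m <ᵇ i ℕ.+ n) ≡ (m <ᵇ n)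
<ᵇ-+ˡ zero    m n = refl
<ᵇ-+ˡ (suc i) m n = <ᵇ-+ˡ i m n

<ᵇ-+ʳ : ∀ i m n → (m ℕ.+ i <ᵇ n ℕ.+ i) ≡ (m <ᵇ n)
<ᵇ-+ʳ i m n = trans (cong₂ _<ᵇ_ (ℕₚ.+-comm m i) (ℕₚ.+-comm n i)) (<ᵇ-+ˡ i m n)

[m+n%d]%d≡[m+n]%d : ∀ m n d .{{_ : NonZero d}} → (m ℕ.+ n % d) % d ≡ (m ℕ.+ n) % d
[m+n%d]%d≡[m+n]%d m n d = begin
  (m ℕ.+ n % d) % d            ≡⟨ %-distribˡ-+ m (n % d) d ⟩
  (m % d ℕ.+ n % d % d) % d    ≡⟨ cong (λ x → (m % d ℕ.+ x) % d) (m%n%n≡m%n n d) ⟩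
  (m % d ℕ.+ n % d) % d        ≡⟨ %-distribˡ-+ m n d ⟨
  (m ℕ.+ n) % d                ∎
  where open ≡-Reasoning

-- FieldOps.rho, which does not depend on the field.
rotate : ∀ {n} → Fin n → Fin n → Fin n
rotate {suc m} i r = fromℕ< (m%n<n (toℕ i ℕ.+ toℕ r) (suc m))

rotate-inverse : ∀ {m} (a b r : Fin (suc m)) → (toℕ a ℕ.+ toℕ b) % suc m ≡ 0 → rotate a (rotate b r) ≡ r
rotate-inverse {m} a b r a+b≡0 = toℕ-injective (begin
  toℕ (rotate a (rotate b r))                     ≡⟨ toℕ-fromℕ< _ ⟩
  (toℕ a ℕ.+ toℕ (rotate b r)) % suc m            ≡⟨ cong (λ x → (toℕ a ℕ.+ x) % suc m) (toℕ-fromℕ< _) ⟩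
  (toℕ a ℕ.+ (toℕ b ℕ.+ toℕ r) % suc m) % suc m   ≡⟨ [m+n%d]%d≡[m+n]%d (toℕ a) _ (suc m) ⟩
  (toℕ a ℕ.+ (toℕ b ℕ.+ toℕ r)) % suc m           ≡⟨ cong (_% suc m) (ℕₚ.+-assoc (toℕ a) _ _) ⟨
  (toℕ a ℕ.+ toℕ b ℕ.+ toℕ r) % suc m             ≡⟨ cong (_% suc m) (ℕₚ.+-comm _ (toℕ r)) ⟩
  (toℕ r ℕ.+ (toℕ a ℕ.+ toℕ b)) % suc m           ≡⟨ [m+n%d]%d≡[m+n]%d (toℕ r) _ (suc m) ⟨
  (toℕ r ℕ.+ (toℕ a ℕ.+ toℕ b) % suc m) % suc m   ≡⟨ cong (λ x → (toℕ r ℕ.+ x) % suc m) a+b≡0 ⟩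
  (toℕ r ℕ.+ 0) % suc m                           ≡⟨ cong (_% suc m) (ℕₚ.+-identityʳ (toℕ r)) ⟩
  toℕ r % suc m                                   ≡⟨ m<n⇒m%n≡m (toℕ<n r) ⟩
  toℕ r                                           ∎)
  where open ≡-Reasoning

module Rotation {m : ℕ} (i : Fin (suc m)) where

  wraps : Fin (suc m) → Bool
  wraps r = suc m ≤ᵇ toℕ i ℕ.+ toℕ r

  data Wrapping (r : Fin (suc m)) : Bool → Set where
    inside  : toℕ (rotate i r) ≡ toℕ i ℕ.+ toℕ r → toℕ i ℕ.+ toℕ r < suc m → Wrapping r false
    outside : toℕ (rotate i r) ℕ.+ suc m ≡ toℕ i ℕ.+ toℕ r → suc m ≤ toℕ i ℕ.+ toℕ r → Wrapping r true

  wrapping : ∀ r → Wrapping r (wraps r)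
  wrapping r with m <ᵇ toℕ i ℕ.+ toℕ r | ℕₚ.<ᵇ-reflects-< m (toℕ i ℕ.+ toℕ r)
  ... | false | ofⁿ n≰i+r = inside (trans (toℕ-fromℕ< _) (m<n⇒m%n≡m (ℕₚ.≰⇒> n≰i+r))) (ℕₚ.≰⇒> n≰i+r)
  ... | true  | ofʸ n≤i+r = outside (begin
    toℕ (rotate i r) ℕ.+ suc m              ≡⟨ cong (ℕ._+ suc m) (toℕ-fromℕ< _) ⟩
    (toℕ i ℕ.+ toℕ r) % suc m ℕ.+ suc m     ≡⟨ cong (λ x → x % suc m ℕ.+ suc m) (ℕₚ.m∸n+n≡m n≤i+r) ⟨
    (excess ℕ.+ suc m) % suc m ℕ.+ suc m    ≡⟨ cong (ℕ._+ suc m) ([m+n]%n≡m%n excess (suc m)) ⟩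
    excess % suc m ℕ.+ suc m                ≡⟨ cong (ℕ._+ suc m) (m<n⇒m%n≡m excess<n) ⟩
    excess ℕ.+ suc m                        ≡⟨ ℕₚ.m∸n+n≡m n≤i+r ⟩
    toℕ i ℕ.+ toℕ r                         ∎) n≤i+r
    where
    open ≡-Reasoning
    excess : ℕ
    excess = toℕ i ℕ.+ toℕ r ∸ suc m
    excess<n : excess < suc m
    excess<n = subst (excess <_) (ℕₚ.m+n∸n≡m (suc m) (suc m))
                     (ℕₚ.∸-monoˡ-< (ℕₚ.+-mono-< (toℕ<n i) (toℕ<n r)) n≤i+r)

  outside-before-inside : ∀ {r s} → Wrapping r true → Wrapping s false →
                          toℕ (rotate i r) < toℕ (rotate i s) × toℕ s < toℕ r
  outside-before-inside {r} {s} (outside ρr+n≡i+r n≤i+r) (inside ρs≡i+s i+s<n) = ρr<ρs , s<r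
    where
    ρr<i : toℕ (rotate i r) < toℕ i
    ρr<i = ℕₚ.+-cancelʳ-< (suc m) _ _
      (subst (_< toℕ i ℕ.+ suc m) (sym ρr+n≡i+r) (ℕₚ.+-monoʳ-< (toℕ i) (toℕ<n r)))
    ρr<ρs : toℕ (rotate i r) < toℕ (rotate i s)
    ρr<ρs = ℕₚ.<-≤-trans ρr<i (subst (toℕ i ≤_) (sym ρs≡i+s) (ℕₚ.m≤m+n (toℕ i) (toℕ s)))
    s<r : toℕ s < toℕ r
    s<r = ℕₚ.+-cancelˡ-< (toℕ i) _ _ (ℕₚ.<-≤-trans i+s<n n≤i+r)

  rotate-<ᵇ : ∀ r s → (toℕ (rotate i s) <ᵇ toℕ (rotate i r)) ≡ (toℕ s <ᵇ toℕ r) xor (wraps r xor wraps s)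
  rotate-<ᵇ r s with wraps r | wrapping r | wraps s | wrapping s
  ... | false | inside ρr≡i+r _ | false | inside ρs≡i+s _ =
    trans (cong₂ _<ᵇ_ ρs≡i+s ρr≡i+r) (trans (<ᵇ-+ˡ (toℕ i) (toℕ s) (toℕ r)) (sym (xor-identityʳ _)))
  ... | true | outside ρr+n≡i+r _ | true | outside ρs+n≡i+s _ =
    trans (sym (<ᵇ-+ʳ (suc m) (toℕ (rotate i s)) (toℕ (rotate i r))))
          (trans (cong₂ _<ᵇ_ ρs+n≡i+s ρr+n≡i+r)
                 (trans (<ᵇ-+ˡ (toℕ i) (toℕ s) (toℕ r)) (sym (xor-identityʳ _))))
  ... | true | wr@(outside _ _) | false | ws@(inside _ _) =
    let ρr<ρs , s<r = outside-before-inside wr ws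
    in trans (dec-false (_ <? _) (ℕₚ.<-asym ρr<ρs)) (sym (cong (_xor true) (dec-true (_ <? _) s<r)))
  ... | false | wr@(inside _ _) | true | ws@(outside _ _) =
    let ρs<ρr , r<s = outside-before-inside ws wr
    in trans (dec-true (_ <? _) ρs<ρr) (sym (cong (_xor true) (dec-false (_ <? _) (ℕₚ.<-asym r<s))))

  parity-rotate : ∀ r → parity (toℕ (rotate i r)) ≡
                        (parity (toℕ i) xor parity (toℕ r)) xor (wraps r ∧ parity (suc m))
  parity-rotate r with wraps r | wrapping r
  ... | false | inside ρr≡i+r _ =
    trans (cong parity ρr≡i+r) (trans (parity-+ (toℕ i) (toℕ r)) (sym (xor-identityʳ _)))
  ... | true | outside ρr+n≡i+r _ = begin
    parity (toℕ (rotate i r))                                   ≡⟨ cancel _ (parity (suc m)) ⟩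
    (parity (toℕ (rotate i r)) xor parity (suc m)) xor parity (suc m)
      ≡⟨ cong (_xor parity (suc m)) (parity-+ (toℕ (rotate i r)) (suc m)) ⟨
    parity (toℕ (rotate i r) ℕ.+ suc m) xor parity (suc m)
      ≡⟨ cong (λ x → parity x xor parity (suc m)) ρr+n≡i+r ⟩
    parity (toℕ i ℕ.+ toℕ r) xor parity (suc m)
      ≡⟨ cong (_xor parity (suc m)) (parity-+ (toℕ i) (toℕ r)) ⟩
    (parity (toℕ i) xor parity (toℕ r)) xor parity (suc m)      ∎
    where
    open ≡-Reasoning
    cancel : ∀ a b → a ≡ (a xor b) xor b
    cancel = solve-∀ 𝔹-ring

  signBit-rotate : ∀ {k} (σ : Fin k → Fin (suc m)) → parity (suc m) xor parity k ≡ true →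
                   signBit (rotate i ∘ σ) ≡ signBit σ xor (parity (toℕ i) ∧ parity k)
  signBit-rotate {k} σ n+k-odd = begin
    inversionParity (rotate i ∘ σ) xor (imageParity (rotate i ∘ σ) xor z)
      ≡⟨ cong₂ (λ a b → a xor (b xor z)) inversions-rotate images-rotate ⟩
    (I xor (w ∧ (true xor pk))) xor ((((pk ∧ pi) xor S) xor (w ∧ (true xor pk))) xor z)
      ≡⟨ regroup I w pk S pi z ⟩
    (I xor (S xor z)) xor (pi ∧ pk) ∎
    where
    open ≡-Reasoning
    I S z w pi pk : Bool
    I  = inversionParity σ
    S  = imageParity σ
    z  = parity (sumIdx k)
    w  = ⨁ (wraps ∘ σ)
    pi = parity (toℕ i)
    pk = parity k

    inversions-rotate : inversionParity (rotate i ∘ σ) ≡ I xor (w ∧ parity (suc k))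
    inversions-rotate = begin
      inversionParity (rotate i ∘ σ)
        ≡⟨ pairParity-cong k (λ α β → rotate-<ᵇ (σ α) (σ β)) ⟩
      pairParity k (λ α β → (toℕ (σ β) <ᵇ toℕ (σ α)) xor (wraps (σ α) xor wraps (σ β)))
        ≡⟨ pairParity-xor k _ (λ α β → wraps (σ α) xor wraps (σ β)) ⟩
      I xor pairParity k (λ α β → wraps (σ α) xor wraps (σ β))
        ≡⟨ cong (I xor_) (pairParity-mixed k (wraps ∘ σ)) ⟩
      I xor (w ∧ parity (suc k)) ∎

    images-rotate : imageParity (rotate i ∘ σ) ≡ ((pk ∧ pi) xor S) xor (w ∧ (true xor pk))
    images-rotate = begin
      ⨁ (λ α → parity (toℕ (rotate i (σ α))))
        ≡⟨ ⊕.sum-cong-≗ (parity-rotate ∘ σ) ⟩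
      ⨁ (λ α → (pi xor parity (toℕ (σ α))) xor (wraps (σ α) ∧ parity (suc m)))
        ≡⟨ ⊕.∑-distrib-+ (λ α → pi xor parity (toℕ (σ α))) (λ α → wraps (σ α) ∧ parity (suc m)) ⟩
      ⨁ (λ α → pi xor parity (toℕ (σ α))) xor ⨁ (λ α → wraps (σ α) ∧ parity (suc m))
        ≡⟨ cong₂ _xor_ (⊕.∑-distrib-+ (λ _ → pi) (λ α → parity (toℕ (σ α))))
                       (sym (*-distribʳ-sum (parity (suc m)) (wraps ∘ σ))) ⟩
      (⨁ {k} (λ _ → pi) xor S) xor (w ∧ parity (suc m))
        ≡⟨ cong₂ (λ a b → (a xor S) xor (w ∧ b)) (⨁-const k pi) n≡1+k ⟩
      ((pk ∧ pi) xor S) xor (w ∧ (true xor pk)) ∎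
      where
      cancel : ∀ a b → a ≡ (a xor b) xor b
      cancel = solve-∀ 𝔹-ring
      n≡1+k : parity (suc m) ≡ true xor pk
      n≡1+k = trans (cancel (parity (suc m)) pk) (cong (_xor pk) n+k-odd)

    regroup : ∀ I w pk S pi z →
      (I xor (w ∧ (true xor pk))) xor ((((pk ∧ pi) xor S) xor (w ∧ (true xor pk))) xor z) ≡
      (I xor (S xor z)) xor (pi ∧ pk)
    regroup = solve-∀ 𝔹-ring

  rotation : Permutation′ (suc m)
  rotation = P.permutation (rotate i) (rotate i⁻)
    (λ r → rotate-inverse i i⁻ r i+i⁻≡0)
    (λ r → rotate-inverse i⁻ i r (trans (cong (_% suc m) (ℕₚ.+-comm (toℕ i⁻) (toℕ i))) i+i⁻≡0))
    where
    open ≡-Reasoning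
    i⁻ : Fin (suc m)
    i⁻ = fromℕ< (m%n<n (suc m ∸ toℕ i) (suc m))
    i+i⁻≡0 : (toℕ i ℕ.+ toℕ i⁻) % suc m ≡ 0
    i+i⁻≡0 = begin
      (toℕ i ℕ.+ toℕ i⁻) % suc m                    ≡⟨ cong (λ x → (toℕ i ℕ.+ x) % suc m) (toℕ-fromℕ< _) ⟩
      (toℕ i ℕ.+ (suc m ∸ toℕ i) % suc m) % suc m   ≡⟨ [m+n%d]%d≡[m+n]%d (toℕ i) (suc m ∸ toℕ i) (suc m) ⟩
      (toℕ i ℕ.+ (suc m ∸ toℕ i)) % suc m           ≡⟨ cong (_% suc m) (ℕₚ.m+[n∸m]≡n (ℕₚ.<⇒≤ (toℕ<n i))) ⟩
      suc m % suc m                                 ≡⟨ n%n≡0 (suc m) ⟩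
      0                                             ∎

-- The Cullis determinant

module CullisDeterminant {c ℓ} (F : Field c ℓ) where
  open FieldOps F hiding (zero)
    renaming (refl to ≈-refl; sym to ≈-sym; trans to ≈-trans; reflexive to ≈-reflexive)
  open import Algebra.Properties.Ring ring using (-1*x≈-x; -‿involutive)
  open import Algebra.Properties.CommutativeSemigroup *-commutativeSemigroup using (x∙yz≈y∙xz)
  open import Relation.Binary.Reasoning.Setoid setoid
  module Σ+ = CommutativeMonoidSum +-commutativeMonoid
  module Π = CommutativeMonoidSum *-commutativeMonoid
  module +L = ListSum +-monoid
  module *L = ListSum *-monoid

  sign : Bool → Carrier
  sign false = 1#
  sign true  = - 1#

  sign-xor : ∀ a b → sign (a xor b) ≈ sign a * sign b
  sign-xor false b     = ≈-sym (*-identityˡ _)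
  sign-xor true  false = ≈-sym (*-identityʳ _)
  sign-xor true  true  = ≈-sym (≈-trans (-1*x≈-x (- 1#)) (-‿involutive 1#))

  sign-square : ∀ b → sign b * sign b ≈ 1#
  sign-square b = ≈-trans (≈-sym (sign-xor b b)) (≈-reflexive (cong sign (xor-same b)))

  negOnePow≈sign : ∀ m → negOnePow m ≈ sign (parity m)
  negOnePow≈sign zero    = ≈-refl
  negOnePow≈sign (suc m) = ≈-trans (-‿cong (negOnePow≈sign m)) (sign-not (parity m))
    where
    sign-not : ∀ b → - sign b ≈ sign (not b)
    sign-not false = ≈-refl
    sign-not true  = -‿involutive 1#

  ∏-sign : ∀ {k} (b : Fin k → Bool) → Π.sum (sign ∘ b) ≈ sign (⨁ b)
  ∏-sign {zero}  b = ≈-refl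
  ∏-sign {suc k} b = ≈-trans (*-congˡ (∏-sign (b ∘ suc))) (≈-sym (sign-xor (b zero) (⨁ (b ∘ suc))))

  sgnNK≈sign : ∀ {k n} (σ : Fin k → Fin n) → sgnNK σ ≈ sign (signBit σ)
  sgnNK≈sign {k} σ =
    ≈-trans (negOnePow≈sign (inversions σ ℕ.+ (sumImage σ ℕ.+ sumIdx k)))
            (≈-reflexive (cong sign (parity-signExponent σ)))

  summand : ∀ {n k} → Mat Carrier n k → (Fin k → Fin n) → Carrier
  summand X σ = if isInjective σ then sgnNK σ * prodCol X σ else 0#

  -- allFuns extends functions by an anonymous pattern lambda, which agrees with _∷ᶠ_ only pointwise.
  Extensional : ∀ {k n} → ((Fin k → Fin n) → Carrier) → Set c
  Extensional h = ∀ {σ τ} → σ ≗ τ → h σ ≡ h τ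

  summand-cong : ∀ {n k} (X : Mat Carrier n k) → Extensional (summand X)
  summand-cong {n} {k} X {σ} {τ} σ≗τ =
    cong₂ (λ b x → if b then x else 0#) injective≡ (cong₂ _*_ (cong negOnePow exponent≡) product≡)
    where
    injective≡ : isInjective σ ≡ isInjective τ
    injective≡ = foldr-cong (λ (α , β) b → cong (λ x → not x ∧ b)
                                                (cong₂ (λ x y → does (x ≟ y)) (σ≗τ α) (σ≗τ β)))
                            refl (pairs k)
    inversions≡ : inversions σ ≡ inversions τ
    inversions≡ = foldr-cong (λ (α , β) m → cong (λ b → (if b then 1 else 0) ℕ.+ m)
                                                  (cong₂ (λ x y → toℕ x <ᵇ toℕ y) (σ≗τ β) (σ≗τ α)))
                             refl (pairs k)
    sumImage≡ : sumImage σ ≡ sumImage τ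
    sumImage≡ = foldr-cong (λ α m → cong (λ x → toℕ x ℕ.+ m) (σ≗τ α)) refl (allFin k)
    exponent≡ : inversions σ ℕ.+ (sumImage σ ℕ.+ sumIdx k) ≡ inversions τ ℕ.+ (sumImage τ ℕ.+ sumIdx k)
    exponent≡ = cong₂ ℕ._+_ inversions≡ (cong (λ x → x ℕ.+ sumIdx k) sumImage≡)
    product≡ : prodCol X σ ≡ prodCol X τ
    product≡ = foldr-cong (λ α r → cong (λ x → X x α * r) (σ≗τ α)) refl (allFin k)

  sumFuns : ∀ k n → ((Fin k → Fin n) → Carrier) → Carrier
  sumFuns k n = +L.sumOver (allFuns k n)

  sumFuns-cong : ∀ k n {g h : (Fin k → Fin n) → Carrier} → (∀ σ → g σ ≈ h σ) → sumFuns k n g ≈ sumFuns k n h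
  sumFuns-cong k n = +L.sumOver-cong (allFuns k n)

  sumFuns-*ˡ : ∀ k n a (h : (Fin k → Fin n) → Carrier) → sumFuns k n (λ σ → a * h σ) ≈ a * sumFuns k n h
  sumFuns-*ˡ k n a h = sumOver-*ˡ (allFuns k n)
    where
    sumOver-*ˡ : ∀ xs → +L.sumOver xs (λ σ → a * h σ) ≈ a * +L.sumOver xs h
    sumOver-*ˡ []       = ≈-sym (zeroʳ a)
    sumOver-*ˡ (σ ∷ xs) = ≈-trans (+-congˡ (sumOver-*ˡ xs)) (≈-sym (distribˡ a (h σ) _))

  sumFuns-suc : ∀ k n (h : (Fin (suc k) → Fin n) → Carrier) → Extensional h →
                sumFuns (suc k) n h ≈ Σ+.sum (λ a → sumFuns k n (λ g → h (a ∷ᶠ g)))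
  sumFuns-suc k n h h-ext = ≈-trans (sumOver-extend _) (Σ+.sum-cong-≋ {n} λ a →
    sumFuns-cong k n λ g → ≈-reflexive (h-ext {τ = a ∷ᶠ g} λ { zero → refl ; (suc _) → refl }))
    where
    -- Abstracting the extension map lets unification supply the pattern lambda of allFuns.
    sumOver-extend : ∀ (ext : Fin n → (Fin k → Fin n) → Fin (suc k) → Fin n) →
      +L.sumOver (concatMap (λ a → map (ext a) (allFuns k n)) (allFin n)) h ≈
      Σ+.sum (λ a → sumFuns k n (h ∘ ext a))
    sumOver-extend ext =
      ≈-trans (+L.sumOver-concatMap (λ a → map (ext a) (allFuns k n)) (allFin n) h)
     (≈-trans (≈-reflexive (+L.sumOver-tabulate id (λ a → +L.sumOver (map (ext a) (allFuns k n)) h)))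
              (Σ+.sum-cong-≋ λ a → ≈-reflexive (+L.sumOver-map (ext a) (allFuns k n) h)))

  sumFuns-∘ˡ : ∀ k n (π : Permutation′ n) (h : (Fin k → Fin n) → Carrier) → Extensional h →
               sumFuns k n (λ σ → h ((π ⟨$⟩ʳ_) ∘ σ)) ≈ sumFuns k n h
  sumFuns-∘ˡ zero    n π h h-ext = +-congʳ (≈-reflexive (h-ext (λ ())))
  sumFuns-∘ˡ (suc k) n π h h-ext = begin
    sumFuns (suc k) n (λ σ → h ((π ⟨$⟩ʳ_) ∘ σ))
      ≈⟨ sumFuns-suc k n _ (λ σ≗τ → h-ext (cong (π ⟨$⟩ʳ_) ∘ σ≗τ)) ⟩
    Σ+.sum (λ a → sumFuns k n (λ g → h ((π ⟨$⟩ʳ_) ∘ (a ∷ᶠ g))))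
      ≈⟨ Σ+.sum-cong-≋ (λ a → sumFuns-cong k n λ g →
           ≈-reflexive (h-ext {τ = (π ⟨$⟩ʳ a) ∷ᶠ ((π ⟨$⟩ʳ_) ∘ g)} λ { zero → refl ; (suc _) → refl })) ⟩
    Σ+.sum (λ a → sumFuns k n (λ g → h ((π ⟨$⟩ʳ a) ∷ᶠ ((π ⟨$⟩ʳ_) ∘ g))))
      ≈⟨ Σ+.sum-cong-≋ (λ a → sumFuns-∘ˡ k n π (λ g → h ((π ⟨$⟩ʳ a) ∷ᶠ g)) λ σ≗τ →
           h-ext λ { zero → refl ; (suc α) → σ≗τ α }) ⟩
    Σ+.sum (λ a → sumFuns k n (λ g → h ((π ⟨$⟩ʳ a) ∷ᶠ g)))
      ≈⟨ Σ+.sum-permute (λ a → sumFuns k n (λ g → h (a ∷ᶠ g))) π ⟨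
    Σ+.sum (λ a → sumFuns k n (λ g → h (a ∷ᶠ g)))
      ≈⟨ sumFuns-suc k n h h-ext ⟨
    sumFuns (suc k) n h ∎

  sumFuns-∘ʳ : ∀ k n (p : Perm k) (h : (Fin k → Fin n) → Carrier) → Extensional h →
               sumFuns k n (λ σ → h (σ ∘ (⟦ p ⟧ ⟨$⟩ʳ_))) ≈ sumFuns k n h
  sumFuns-∘ʳ k n idᵖ h h-ext = ≈-refl
  sumFuns-∘ʳ (suc (suc k)) n swap₀₁ h h-ext = begin
    sumFuns (2+ k) n (λ σ → h (σ ∘ (⟦ swap₀₁ ⟧ ⟨$⟩ʳ_)))
      ≈⟨ sumFuns-suc (suc k) n _ (λ σ≗τ → h-ext (σ≗τ ∘ (⟦ swap₀₁ ⟧ ⟨$⟩ʳ_))) ⟩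
    Σ+.sum (λ a → sumFuns (suc k) n (λ g → h ((a ∷ᶠ g) ∘ (⟦ swap₀₁ ⟧ ⟨$⟩ʳ_))))
      ≈⟨ Σ+.sum-cong-≋ {n} (λ a → sumFuns-suc k n _ λ {σ} {τ} σ≗τ →
           h-ext {(a ∷ᶠ σ) ∘ (⟦ swap₀₁ ⟧ ⟨$⟩ʳ_)} {(a ∷ᶠ τ) ∘ (⟦ swap₀₁ ⟧ ⟨$⟩ʳ_)}
                 λ { zero → σ≗τ zero ; (suc zero) → refl ; (suc (suc α)) → σ≗τ (suc α) }) ⟩
    Σ+.sum (λ a → Σ+.sum (λ b → sumFuns k n (λ g → h ((a ∷ᶠ (b ∷ᶠ g)) ∘ (⟦ swap₀₁ ⟧ ⟨$⟩ʳ_)))))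
      ≈⟨ Σ+.sum-cong-≋ (λ a → Σ+.sum-cong-≋ λ b → sumFuns-cong k n λ g →
           ≈-reflexive (h-ext {τ = b ∷ᶠ (a ∷ᶠ g)}
                              λ { zero → refl ; (suc zero) → refl ; (suc (suc _)) → refl })) ⟩
    Σ+.sum (λ a → Σ+.sum (λ b → sumFuns k n (λ g → h (b ∷ᶠ (a ∷ᶠ g)))))
      ≈⟨ Σ+.∑-comm (λ a b → sumFuns k n (λ g → h (b ∷ᶠ (a ∷ᶠ g)))) ⟩
    Σ+.sum (λ b → Σ+.sum (λ a → sumFuns k n (λ g → h (b ∷ᶠ (a ∷ᶠ g)))))
      ≈⟨ Σ+.sum-cong-≋ (λ b → sumFuns-suc k n (λ g → h (b ∷ᶠ g)) λ σ≗τ →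
           h-ext λ { zero → refl ; (suc α) → σ≗τ α }) ⟨
    Σ+.sum (λ b → sumFuns (suc k) n (λ g → h (b ∷ᶠ g)))
      ≈⟨ sumFuns-suc (suc k) n h h-ext ⟨
    sumFuns (2+ k) n h ∎
  sumFuns-∘ʳ (suc k) n (lift p) h h-ext = begin
    sumFuns (suc k) n (λ σ → h (σ ∘ (⟦ lift p ⟧ ⟨$⟩ʳ_)))
      ≈⟨ sumFuns-suc k n _ (λ σ≗τ → h-ext (σ≗τ ∘ (⟦ lift p ⟧ ⟨$⟩ʳ_))) ⟩
    Σ+.sum (λ a → sumFuns k n (λ g → h ((a ∷ᶠ g) ∘ (⟦ lift p ⟧ ⟨$⟩ʳ_))))
      ≈⟨ Σ+.sum-cong-≋ (λ a → sumFuns-cong k n λ g →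
           ≈-reflexive (h-ext {τ = a ∷ᶠ (g ∘ (⟦ p ⟧ ⟨$⟩ʳ_))} λ { zero → refl ; (suc _) → refl })) ⟩
    Σ+.sum (λ a → sumFuns k n (λ g → h (a ∷ᶠ (g ∘ (⟦ p ⟧ ⟨$⟩ʳ_)))))
      ≈⟨ Σ+.sum-cong-≋ (λ a → sumFuns-∘ʳ k n p (λ g → h (a ∷ᶠ g)) λ σ≗τ →
           h-ext λ { zero → refl ; (suc α) → σ≗τ α }) ⟩
    Σ+.sum (λ a → sumFuns k n (λ g → h (a ∷ᶠ g)))
      ≈⟨ sumFuns-suc k n h h-ext ⟨
    sumFuns (suc k) n h ∎
  sumFuns-∘ʳ k n (p ∘ᵖ q) h h-ext =
    ≈-trans (sumFuns-∘ʳ k n p (λ σ → h (σ ∘ (⟦ q ⟧ ⟨$⟩ʳ_))) (λ σ≗τ → h-ext (σ≗τ ∘ (⟦ q ⟧ ⟨$⟩ʳ_))))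
            (sumFuns-∘ʳ k n q h h-ext)

  summand≈*summand : ∀ {n k} {X Y : Mat Carrier n k} {σ τ : Fin k → Fin n} s →
    isInjective τ ≡ isInjective σ →
    (Injective _≡_ _≡_ σ → sgnNK τ * prodCol Y τ ≈ s * (sgnNK σ * prodCol X σ)) →
    summand Y τ ≈ s * summand X σ
  summand≈*summand {σ = σ} s τ≡σ relate rewrite τ≡σ with isInjective σ in σ-injective
  ... | false = ≈-sym (zeroʳ s)
  ... | true  = relate (Equivalence.to (T-isInjective σ) (Equivalence.from T-≡ σ-injective))

  prodCol≡∏ : ∀ {n k} (X : Mat Carrier n k) σ → prodCol X σ ≡ Π.sum (λ α → X (σ α) α)
  prodCol≡∏ X σ = *L.sumOver-tabulate id (λ α → X (σ α) α)

  cullisDet-cong : ∀ {n k} {X Y : Mat Carrier n k} → (∀ r c → X r c ≈ Y r c) → cullisDet X ≈ cullisDet Y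
  cullisDet-cong {n} {k} {X} {Y} X≈Y = sumFuns-cong k n summand≈
    where
    summand≈ : ∀ σ → summand X σ ≈ summand Y σ
    summand≈ σ with isInjective σ
    ... | false = ≈-refl
    ... | true  = *-congˡ (*L.sumOver-cong (allFin k) (λ α → X≈Y (σ α) α))

  cullisDet-scaleColumns : ∀ {n k} (a : Fin k → Carrier) (X : Mat Carrier n k) →
                           cullisDet (λ r c → a c * X r c) ≈ Π.sum a * cullisDet X
  cullisDet-scaleColumns {n} {k} a X =
    ≈-trans (sumFuns-cong k n summand-scale) (sumFuns-*ˡ k n (Π.sum a) (summand X))
    where
    aX : Mat Carrier n k
    aX r c = a c * X r c
    summand-scale : ∀ σ → summand aX σ ≈ Π.sum a * summand X σ
    summand-scale σ = summand≈*summand {X = X} {aX} {σ} {σ} (Π.sum a) refl λ _ → begin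
      sgnNK σ * prodCol aX σ
        ≈⟨ *-congˡ (≈-reflexive (prodCol≡∏ aX σ)) ⟩
      sgnNK σ * Π.sum (λ α → a α * X (σ α) α)
        ≈⟨ *-congˡ (Π.∑-distrib-+ a (λ α → X (σ α) α)) ⟩
      sgnNK σ * (Π.sum a * Π.sum (λ α → X (σ α) α))
        ≈⟨ *-congˡ (*-congˡ (≈-reflexive (prodCol≡∏ X σ))) ⟨
      sgnNK σ * (Π.sum a * prodCol X σ)
        ≈⟨ x∙yz≈y∙xz (sgnNK σ) (Π.sum a) (prodCol X σ) ⟩
      Π.sum a * (sgnNK σ * prodCol X σ) ∎

  cullisDet-permuteColumns : ∀ {n k} (p : Perm k) (X : Mat Carrier n k) →
                             cullisDet (λ r c → X r (⟦ p ⟧ ⟨$⟩ʳ c)) ≈ sign (oddPerm p) * cullisDet X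
  cullisDet-permuteColumns {n} {k} p X = begin
    sumFuns k n (summand Xp)                            ≈⟨ sumFuns-∘ʳ k n p (summand Xp) (summand-cong Xp) ⟨
    sumFuns k n (λ σ → summand Xp (σ ∘ π))              ≈⟨ sumFuns-cong k n summand-permute ⟩
    sumFuns k n (λ σ → sign (oddPerm p) * summand X σ)  ≈⟨ sumFuns-*ˡ k n (sign (oddPerm p)) (summand X) ⟩
    sign (oddPerm p) * cullisDet X                      ∎
    where
    π : Fin k → Fin k
    π = ⟦ p ⟧ ⟨$⟩ʳ_
    Xp : Mat Carrier n k
    Xp r c = X r (π c)
    summand-permute : ∀ σ → summand Xp (σ ∘ π) ≈ sign (oddPerm p) * summand X σ
    summand-permute σ = summand≈*summand {X = X} {Xp} {σ} (sign (oddPerm p)) (isInjective-∘ʳ σ ⟦ p ⟧)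
      λ σ-injective → begin
      sgnNK (σ ∘ π) * prodCol Xp (σ ∘ π)
        ≈⟨ *-cong (sgnNK≈sign (σ ∘ π)) (≈-reflexive (prodCol≡∏ Xp (σ ∘ π))) ⟩
      sign (signBit (σ ∘ π)) * Π.sum (λ α → X (σ (π α)) (π α))
        ≈⟨ *-cong (≈-reflexive (cong sign (sym (signBit-∘ᵖ p σ σ-injective))))
                  (Π.sum-permute (λ α → X (σ α) α) ⟦ p ⟧) ⟨
      sign (oddPerm p xor signBit σ) * Π.sum (λ α → X (σ α) α)
        ≈⟨ *-cong (sign-xor (oddPerm p) (signBit σ)) (≈-reflexive (sym (prodCol≡∏ X σ))) ⟩
      (sign (oddPerm p) * sign (signBit σ)) * prodCol X σ
        ≈⟨ *-assoc _ _ _ ⟩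
      sign (oddPerm p) * (sign (signBit σ) * prodCol X σ)
        ≈⟨ *-congˡ (*-congʳ (sgnNK≈sign σ)) ⟨
      sign (oddPerm p) * (sgnNK σ * prodCol X σ) ∎

  cullisDet-rotateRows : ∀ {m k} (i : Fin (suc m)) (X : Mat Carrier (suc m) k) →
    parity (suc m) xor parity k ≡ true →
    cullisDet (λ r c → X (rotate i r) c) ≈ sign (parity (toℕ i) ∧ parity k) * cullisDet X
  cullisDet-rotateRows {m} {k} i X n+k-odd = begin
    sumFuns k (suc m) (summand Xρ)
      ≈⟨ sumFuns-cong k (suc m) summand-rotate ⟩
    sumFuns k (suc m) (λ σ → sign e * summand X (rotate i ∘ σ))
      ≈⟨ sumFuns-*ˡ k (suc m) (sign e) (λ σ → summand X (rotate i ∘ σ)) ⟩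
    sign e * sumFuns k (suc m) (λ σ → summand X (rotate i ∘ σ))
      ≈⟨ *-congˡ (sumFuns-∘ˡ k (suc m) (Rotation.rotation i) (summand X) (summand-cong X)) ⟩
    sign e * cullisDet X ∎
    where
    e : Bool
    e = parity (toℕ i) ∧ parity k
    Xρ : Mat Carrier (suc m) k
    Xρ r c = X (rotate i r) c
    summand-rotate : ∀ σ → summand Xρ σ ≈ sign e * summand X (rotate i ∘ σ)
    summand-rotate σ =
      summand≈*summand {X = X} {Xρ} {rotate i ∘ σ} {σ} (sign e) (sym (isInjective-∘ˡ (Rotation.rotation i) σ))
      λ _ → begin
      sgnNK σ * prodCol X (rotate i ∘ σ)
        ≈⟨ *-congʳ (sgnNK≈sign σ) ⟩
      sign (signBit σ) * prodCol X (rotate i ∘ σ)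
        ≈⟨ *-congʳ (≈-reflexive (cong sign (cancel e (signBit σ)))) ⟩
      sign (e xor (signBit σ xor e)) * prodCol X (rotate i ∘ σ)
        ≈⟨ *-congʳ (≈-reflexive (cong (λ b → sign (e xor b)) (Rotation.signBit-rotate i σ n+k-odd))) ⟨
      sign (e xor signBit (rotate i ∘ σ)) * prodCol X (rotate i ∘ σ)
        ≈⟨ *-congʳ (≈-trans (sign-xor e (signBit (rotate i ∘ σ)))
                            (*-congˡ (≈-sym (sgnNK≈sign (rotate i ∘ σ))))) ⟩
      (sign e * sgnNK (rotate i ∘ σ)) * prodCol X (rotate i ∘ σ)
        ≈⟨ *-assoc _ _ _ ⟩
      sign e * (sgnNK (rotate i ∘ σ) * prodCol X (rotate i ∘ σ)) ∎
      where
      cancel : ∀ e b → b ≡ e xor (b xor e)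
      cancel = solve-∀ 𝔹-ring

  permuteSigned : ∀ {n k} → (Fin k → Bool) → Permutation′ n → Permutation′ k →
                  Mat Carrier n k → Mat Carrier n k
  permuteSigned e π τ X r c = sign (e c) * X (π ⟨$⟩ʳ r) (τ ⟨$⟩ʳ c)

  module _ {n k} (e : Fin k → Bool) (π : Permutation′ n) (τ : Permutation′ k) where

    permuteSigned-+ : ∀ (X Y : Mat Carrier n k) r c →
      permuteSigned e π τ (λ p q → X p q + Y p q) r c ≈
      permuteSigned e π τ X r c + permuteSigned e π τ Y r c
    permuteSigned-+ X Y r c = distribˡ (sign (e c)) _ _

    permuteSigned-* : ∀ a (X : Mat Carrier n k) r c →
      permuteSigned e π τ (λ p q → a * X p q) r c ≈ a * permuteSigned e π τ X r c
    permuteSigned-* a X r c = x∙yz≈y∙xz (sign (e c)) a _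

    permuteSigned-cong : ∀ {X Y : Mat Carrier n k} → (∀ r c → X r c ≈ Y r c) →
      ∀ r c → permuteSigned e π τ X r c ≈ permuteSigned e π τ Y r c
    permuteSigned-cong X≈Y r c = *-congˡ (X≈Y _ _)

    permuteSigned⁻¹ : Mat Carrier n k → Mat Carrier n k
    permuteSigned⁻¹ = permuteSigned (e ∘ (τ ⟨$⟩ˡ_)) (P.flip π) (P.flip τ)

    permuteSigned⁻¹-inverseˡ : ∀ X r c → permuteSigned⁻¹ (permuteSigned e π τ X) r c ≈ X r c
    permuteSigned⁻¹-inverseˡ X r c = begin
      sign (e c′) * (sign (e c′) * X (π ⟨$⟩ʳ r′) (τ ⟨$⟩ʳ c′))   ≈⟨ *-assoc _ _ _ ⟨
      (sign (e c′) * sign (e c′)) * X (π ⟨$⟩ʳ r′) (τ ⟨$⟩ʳ c′)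
        ≈⟨ *-cong (sign-square (e c′)) (≈-reflexive (cong₂ X (P.inverseʳ π) (P.inverseʳ τ))) ⟩
      1# * X r c                                              ≈⟨ *-identityˡ (X r c) ⟩
      X r c                                                   ∎
      where
      r′ = π ⟨$⟩ˡ r
      c′ = τ ⟨$⟩ˡ c

    permuteSigned⁻¹-inverseʳ : ∀ X r c → permuteSigned e π τ (permuteSigned⁻¹ X) r c ≈ X r c
    permuteSigned⁻¹-inverseʳ X r c = begin
      sign (e c) * (sign (e (τ ⟨$⟩ˡ (τ ⟨$⟩ʳ c))) * X r″ (τ ⟨$⟩ˡ (τ ⟨$⟩ʳ c)))
        ≈⟨ *-congˡ (≈-reflexive (cong (λ d → sign (e d) * X r″ d) (P.inverseˡ τ))) ⟩
      sign (e c) * (sign (e c) * X r″ c)                      ≈⟨ *-assoc _ _ _ ⟨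
      (sign (e c) * sign (e c)) * X r″ c
        ≈⟨ *-cong (sign-square (e c)) (≈-reflexive (cong (λ s → X s c) (P.inverseˡ π))) ⟩
      1# * X r c                                              ≈⟨ *-identityˡ (X r c) ⟩
      X r c                                                   ∎
      where
      r″ = π ⟨$⟩ˡ (π ⟨$⟩ʳ r)

-- The map SCS

module SCSProperties {c ℓ} (F : Field c ℓ) {m k : ℕ} (i : Fin (suc m)) (j : Fin (suc k)) where
  open FieldOps F hiding (zero)
    renaming (refl to ≈-refl; sym to ≈-sym; trans to ≈-trans; reflexive to ≈-reflexive)
  open CullisDeterminant F
  open import Relation.Binary.Reasoning.Setoid setoid

  ρ : Permutation′ (suc m)
  ρ = Rotation.rotation i

  τ : Permutation′ (suc k)
  τ = ⟦ swap₀ j ⟧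

  columnSign : Fin (suc k) → Bool
  columnSign zero    = parity (toℕ i) xor not (does (j ≟ zero))
  columnSign (suc _) = parity (toℕ i)

  SCS≈permuteSigned : ∀ X r c → SCS i j X r c ≈ permuteSigned columnSign ρ τ X r c
  SCS≈permuteSigned X r zero = begin
    negOnePow (toℕ i) * (negOnePow (if does (j ≟ zero) then 0 else 1) * X (rotate i r) j)
      ≈⟨ *-cong (negOnePow≈sign (toℕ i)) (*-congʳ (negOnePow-if (does (j ≟ zero)))) ⟩
    sign (parity (toℕ i)) * (sign (not (does (j ≟ zero))) * X (rotate i r) j)
      ≈⟨ *-assoc _ _ _ ⟨
    (sign (parity (toℕ i)) * sign (not (does (j ≟ zero)))) * X (rotate i r) j
      ≈⟨ *-cong (sign-xor (parity (toℕ i)) (not (does (j ≟ zero))))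
                (≈-reflexive (cong (X (rotate i r)) (swap₀-apply j zero))) ⟨
    sign (columnSign zero) * X (rotate i r) (⟦ swap₀ j ⟧ ⟨$⟩ʳ zero) ∎
    where
    negOnePow-if : ∀ b → negOnePow (if b then 0 else 1) ≈ sign (not b)
    negOnePow-if false = ≈-refl
    negOnePow-if true  = ≈-refl
  SCS≈permuteSigned X r (suc c) = begin
    (if does (suc c ≟ j) then negOnePow (toℕ i) * X (rotate i r) zero
                         else negOnePow (toℕ i) * X (rotate i r) (suc c))
      ≡⟨ if-float (λ d → negOnePow (toℕ i) * X (rotate i r) d) (does (suc c ≟ j)) ⟨
    negOnePow (toℕ i) * X (rotate i r) (if does (suc c ≟ j) then zero else suc c)
      ≈⟨ *-cong (negOnePow≈sign (toℕ i)) (≈-reflexive (cong (X (rotate i r)) (sym (swap₀-apply j (suc c))))) ⟩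
    sign (columnSign (suc c)) * X (rotate i r) (⟦ swap₀ j ⟧ ⟨$⟩ʳ suc c) ∎

  SCS-+ : ∀ (X Y : Mat Carrier (suc m) (suc k)) r c →
          SCS i j (λ p q → X p q + Y p q) r c ≈ SCS i j X r c + SCS i j Y r c
  SCS-+ X Y r c = ≈-trans (SCS≈permuteSigned (λ p q → X p q + Y p q) r c) (≈-trans
    (permuteSigned-+ columnSign ρ τ X Y r c)
    (≈-sym (+-cong (SCS≈permuteSigned X r c) (SCS≈permuteSigned Y r c))))

  SCS-* : ∀ a (X : Mat Carrier (suc m) (suc k)) r c → SCS i j (λ p q → a * X p q) r c ≈ a * SCS i j X r c
  SCS-* a X r c = ≈-trans (SCS≈permuteSigned (λ p q → a * X p q) r c) (≈-trans
    (permuteSigned-* columnSign ρ τ a X r c) (*-congˡ (≈-sym (SCS≈permuteSigned X r c))))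

  SCS⁻¹ : Mat Carrier (suc m) (suc k) → Mat Carrier (suc m) (suc k)
  SCS⁻¹ = permuteSigned⁻¹ columnSign ρ τ

  SCS⁻¹-inverseˡ : ∀ X r c → SCS⁻¹ (SCS i j X) r c ≈ X r c
  SCS⁻¹-inverseˡ X r c = ≈-trans
    (permuteSigned-cong (columnSign ∘ (τ ⟨$⟩ˡ_)) (P.flip ρ) (P.flip τ) (SCS≈permuteSigned X) r c)
    (permuteSigned⁻¹-inverseˡ columnSign ρ τ X r c)

  SCS⁻¹-inverseʳ : ∀ X r c → SCS i j (SCS⁻¹ X) r c ≈ X r c
  SCS⁻¹-inverseʳ X r c =
    ≈-trans (SCS≈permuteSigned (SCS⁻¹ X) r c) (permuteSigned⁻¹-inverseʳ columnSign ρ τ X r c)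

  cullisDet-SCS : parity (suc m) xor parity (suc k) ≡ true → ∀ X → cullisDet (SCS i j X) ≈ cullisDet X
  cullisDet-SCS n+k-odd X = begin
    cullisDet (SCS i j X)
      ≈⟨ cullisDet-cong (SCS≈permuteSigned X) ⟩
    cullisDet (λ r c → sign (columnSign c) * X (rotate i r) (τ ⟨$⟩ʳ c))
      ≈⟨ cullisDet-scaleColumns (sign ∘ columnSign) (λ r c → X (rotate i r) (τ ⟨$⟩ʳ c)) ⟩
    Π.sum (sign ∘ columnSign) * cullisDet (λ r c → X (rotate i r) (τ ⟨$⟩ʳ c))
      ≈⟨ *-cong (∏-sign columnSign) (cullisDet-permuteColumns (swap₀ j) (λ r c → X (rotate i r) c)) ⟩
    sign a * (sign b * cullisDet (λ r c → X (rotate i r) c))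
      ≈⟨ *-congˡ (*-congˡ (cullisDet-rotateRows i X n+k-odd)) ⟩
    sign a * (sign b * (sign c′ * cullisDet X))
      ≈⟨ ≈-trans (*-assoc (sign a) (sign b * sign c′) (cullisDet X))
                 (*-congˡ (*-assoc (sign b) (sign c′) (cullisDet X))) ⟨
    (sign a * (sign b * sign c′)) * cullisDet X
      ≈⟨ *-congʳ (≈-trans (sign-xor a (b xor c′)) (*-congˡ (sign-xor b c′))) ⟨
    sign (a xor (b xor c′)) * cullisDet X
      ≡⟨ cong (λ e → sign e * cullisDet X) exponent≡false ⟩
    1# * cullisDet X
      ≈⟨ *-identityˡ (cullisDet X) ⟩
    cullisDet X ∎
    where
    a b c′ : Bool
    a  = ⨁ columnSign
    b  = oddPerm (swap₀ j)
    c′ = parity (toℕ i) ∧ parity (suc k)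
    exponent≡false : a xor (b xor c′) ≡ false
    exponent≡false = trans
      (cong₂ (λ x y → x xor (y xor c′))
             (cong (columnSign zero xor_) (⨁-const k (parity (toℕ i)))) (oddPerm-swap₀ j))
      (cancel (parity (toℕ i)) (not (does (j ≟ zero))) (parity k))
      where
      cancel : ∀ p J q → ((p xor J) xor (q ∧ p)) xor (J xor (p ∧ (true xor q))) ≡ false
      cancel = solve-∀ 𝔹-ring

lemma3p5 : ∀ {c ℓ} (F : Field c ℓ) → let open FieldOps F in
    (n k : ℕ) → 1 ≤ k → k ≤ n → (n ℕ.+ k) % 2 ≡ 1 →
    (i : Fin n) (j : Fin k) →
      -- additivity
      (∀ (X Y : Mat Carrier n k) r c →
         SCS i j (λ p q → X p q + Y p q) r c ≈ SCS i j X r c + SCS i j Y r c)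
      -- homogeneity
      × (∀ (a : Carrier) (X : Mat Carrier n k) r c →
         SCS i j (λ p q → a * X p q) r c ≈ a * SCS i j X r c)
      -- invertibility: a two-sided inverse map exists
      × Σ (Mat Carrier n k → Mat Carrier n k)
          (λ G → (∀ X r c → G (SCS i j X) r c ≈ X r c)
               × (∀ X r c → SCS i j (G X) r c ≈ X r c))
      -- determinant preservation
      × (∀ (X : Mat Carrier n k) → cullisDet (SCS i j X) ≈ cullisDet X)
lemma3p5 F n       zero    ()
lemma3p5 F zero    (suc k) _ _ _ ()
lemma3p5 F (suc m) (suc k) _ _ n+k%2≡1 i j =
  SCS-+ , SCS-* , (SCS⁻¹ , SCS⁻¹-inverseˡ , SCS⁻¹-inverseʳ) , cullisDet-SCS n+k-odd
  where
  open SCSProperties F i j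
  n+k-odd : parity (suc m) xor parity (suc k) ≡ true
  n+k-odd = trans (sym (parity-+ (suc m) (suc k))) (%2≡1⇒parity (suc m ℕ.+ suc k) n+k%2≡1)
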